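{- Let $G$ be a super-minimally $3$-connected graph. If $G$ has an edge $ab$ such that $G\setminus ab$ is not internally $3$-connected, then $G$ has a compatible set $S$ that contains $ab$ as one of its edges.
   Context: All graphs are finite and simple. A graph is $3$-connected if it has more than $3$ vertices and no vertex cut of size less than $3$; super-minimally $3$-connected if it is $3$-connected and no proper subgraph is $3$-connected. For $k\ge 0$, a $k$-separation of a graph $H$ is a pair $\{A,B\}$ of edge-disjoint subgraphs with $A\cup B=H$, $|V(A)\cap V(B)|=k$ and $\min\{|V(A)|,|V(B)|\}\ge k+1$ (isolated vertices allowed). A $2$-connected graph with at least four vertices is internally $3$-connected if for every $2$-separation one side is isomorphic to the $3$-vertex path $P_3$. For a $3$-connected graph $G$, a compatible set is one of: (i) a set of three edges $\{a_1b_1,a_2b_2,a_3b_3\}$ such that $G\setminus\{a_1b_1,a_2b_2,a_3b_3\}$ has a $0$-separation $\{A,B\}$ with $\{a_1,a_2,a_3\}\subseteq V(A)$ and $\{b_1,b_2,b_3\}\subseteq V(B)$; (ii) a set $\{a_1b_1,a_2b_2,c\}$ of two edges and a vertex such that $G\setminus\{a_1b_1,a_2b_2\}$ has a $1$-separation $\{A,B\}$ with $\{a_1,a_2,c\}\subseteq V(A)$, $\{b_1,b_2,c\}\subseteq V(B)$ and $\min\{d_A(c),d_B(c)\}\ge 2$; (iii) a set $\{a_1b_1,c,d\}$ of one edge and two vertices such that $G\setminus a_1b_1$ has a $2$-separation $\{A,B\}$ with $\{a_1,c,d\}\subseteq V(A)$, $\{b_1,c,d\}\subseteq V(B)$ and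 $\min\{d_A(c),d_B(c),d_A(d),d_B(d)\}\ge 2$. -}

module Defs where

open import Data.Nat using (ℕ; _<_; _≤_; suc)
open import Data.Fin using (Fin)
open import Data.Fin.Subset using (Subset; _∈_; _∉_; _∪_; _∩_; ∁; ∣_∣; ⁅_⁆; _⊆_)
open import Data.Fin.Subset.Properties using (x∈p∩q⁺; x∉p⇒x∈∁p)
open import Data.Product using (Σ; ∃; ∃-syntax; _×_; _,_; proj₁; proj₂)
open import Data.Sum using (_⊎_; inj₁; inj₂)
open import Data.List using (List; []; _∷_)
open import Data.List.Relation.Unary.All using (All; map)
open import Relation.Nullary using (¬_)
open import Relation.Binary.PropositionalEquality using (_≡_; _≢_)
open import Relation.Binary.Construct.Closure.ReflexiveTransitive using (Star)
open import Function.Bundles using (_⇔_)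

-- Finite simple graphs.  A graph lives on an ambient finite type Fin n;
-- its vertex set is a subset V ⊆ Fin n, its edge relation E is
-- symmetric, irreflexive and only joins vertices of V.

record Graph (n : ℕ) : Set₁ where
  field
    V     : Subset n
    E     : Fin n → Fin n → Set
    E-sym : ∀ {u v} → E u v → E v u
    E-irr : ∀ {v} → ¬ E v v
    E-V   : ∀ {u v} → E u v → u ∈ V
open Graph public

SameEdge : ∀ {n} → Fin n → Fin n → Fin n → Fin n → Set
SameEdge u v a b = (u ≡ a × v ≡ b) ⊎ (u ≡ b × v ≡ a)

SameEdge-sym : ∀ {n} {u v a b : Fin n} → SameEdge u v a b → SameEdge v u a b
SameEdge-sym (inj₁ (p , q)) = inj₂ (q , p)
SameEdge-sym (inj₂ (p , q)) = inj₁ (q , p)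

_≤G_ : ∀ {n} → Graph n → Graph n → Set
H ≤G G = (V H ⊆ V G) × (∀ {u v} → E H u v → E G u v)

_<G_ : ∀ {n} → Graph n → Graph n → Set
H <G G = (H ≤G G) ×
  ((∃[ v ] (v ∈ V G × v ∉ V H)) ⊎ (∃[ u ] ∃[ v ] (E G u v × ¬ E H u v)))

_─_ : ∀ {n} → Graph n → Subset n → Graph n
G ─ X = record
  { V     = V G ∩ ∁ X
  ; E     = λ u v → E G u v × u ∉ X × v ∉ X
  ; E-sym = λ { (e , p , q) → E-sym G e , q , p }
  ; E-irr = λ { (e , _ , _) → E-irr G e }
  ; E-V   = λ { (e , p , _) → x∈p∩q⁺ (E-V G e , x∉p⇒x∈∁p p) }
  }

_∖E_ : ∀ {n} → Graph n → List (Fin n × Fin n) → Graph n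
G ∖E es = record
  { V     = V G
  ; E     = λ u v → E G u v × All (λ ab → ¬ SameEdge u v (proj₁ ab) (proj₂ ab)) es
  ; E-sym = λ { (e , ps) → E-sym G e , map (λ f s → f (SameEdge-sym s)) ps }
  ; E-irr = λ { (e , _) → E-irr G e }
  ; E-V   = λ { (e , _) → E-V G e }
  }

Connected : ∀ {n} → Graph n → Set
Connected G = ∀ {u v} → u ∈ V G → v ∈ V G → Star (E G) u v

KConnected : ∀ {n} → ℕ → Graph n → Set
KConnected k G = (k < ∣ V G ∣) × (∀ (X : Subset _) → ∣ X ∣ < k → Connected (G ─ X))

SuperMin3Conn : ∀ {n} → Graph n → Set₁
SuperMin3Conn G = KConnected 3 G × (∀ (H : Graph _) → H <G G → ¬ KConnected 3 H)

record KSep {n} (k : ℕ) (H : Graph n) : Set₁ where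
  field
    A B       : Graph n
    union-V   : V A ∪ V B ≡ V H
    union-E   : ∀ {u v} → E H u v ⇔ (E A u v ⊎ E B u v)
    disjoint  : ∀ {u v} → ¬ (E A u v × E B u v)
    meet      : ∣ V A ∩ V B ∣ ≡ k
    bigA      : suc k ≤ ∣ V A ∣
    bigB      : suc k ≤ ∣ V B ∣
open KSep public

IsP3 : ∀ {n} → Graph n → Set
IsP3 H = ∃[ x ] ∃[ y ] ∃[ z ]
  (x ≢ y × y ≢ z × x ≢ z ×
   V H ≡ (⁅ x ⁆ ∪ ⁅ y ⁆) ∪ ⁅ z ⁆ ×
   (∀ {u v} → E H u v ⇔ (SameEdge u v x y ⊎ SameEdge u v y z)))

Internally3Conn : ∀ {n} → Graph n → Set₁
Internally3Conn H = KConnected 2 H × 4 ≤ ∣ V H ∣ ×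
  (∀ (S : KSep 2 H) → IsP3 (A S) ⊎ IsP3 (B S))

Deg≥2 : ∀ {n} → Graph n → Fin n → Set
Deg≥2 A c = ∃[ u ] ∃[ v ] (u ≢ v × E A c u × E A c v)

-- Compatible sets of G containing the edge ab (as a₁b₁, with some orientation)
Orient : ∀ {n} → Fin n → Fin n → Fin n → Fin n → Set
Orient a₁ b₁ a b = SameEdge a₁ b₁ a b

CompatibleI : ∀ {n} → Graph n → Fin n → Fin n → Set₁
CompatibleI G a b = ∃[ a₁ ] ∃[ b₁ ] ∃[ a₂ ] ∃[ b₂ ] ∃[ a₃ ] ∃[ b₃ ]
  (Orient a₁ b₁ a b × E G a₂ b₂ × E G a₃ b₃ ×
   ¬ SameEdge a₁ b₁ a₂ b₂ × ¬ SameEdge a₁ b₁ a₃ b₃ × ¬ SameEdge a₂ b₂ a₃ b₃ ×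
   Σ (KSep 0 (G ∖E ((a₁ , b₁) ∷ (a₂ , b₂) ∷ (a₃ , b₃) ∷ []))) λ S →
     (a₁ ∈ V (A S) × a₂ ∈ V (A S) × a₃ ∈ V (A S)) ×
     (b₁ ∈ V (B S) × b₂ ∈ V (B S) × b₃ ∈ V (B S)))

CompatibleII : ∀ {n} → Graph n → Fin n → Fin n → Set₁
CompatibleII G a b = ∃[ a₁ ] ∃[ b₁ ] ∃[ a₂ ] ∃[ b₂ ] ∃[ c ]
  (Orient a₁ b₁ a b × E G a₂ b₂ × ¬ SameEdge a₁ b₁ a₂ b₂ × c ∈ V G ×
   Σ (KSep 1 (G ∖E ((a₁ , b₁) ∷ (a₂ , b₂) ∷ []))) λ S →
     (a₁ ∈ V (A S) × a₂ ∈ V (A S) × c ∈ V (A S)) ×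
     (b₁ ∈ V (B S) × b₂ ∈ V (B S) × c ∈ V (B S)) ×
     Deg≥2 (A S) c × Deg≥2 (B S) c)

CompatibleIII : ∀ {n} → Graph n → Fin n → Fin n → Set₁
CompatibleIII G a b = ∃[ a₁ ] ∃[ b₁ ] ∃[ c ] ∃[ d ]
  (Orient a₁ b₁ a b × c ∈ V G × d ∈ V G × c ≢ d ×
   Σ (KSep 2 (G ∖E ((a₁ , b₁) ∷ []))) λ S →
     (a₁ ∈ V (A S) × c ∈ V (A S) × d ∈ V (A S)) ×
     (b₁ ∈ V (B S) × c ∈ V (B S) × d ∈ V (B S)) ×
     Deg≥2 (A S) c × Deg≥2 (B S) c × Deg≥2 (A S) d × Deg≥2 (B S) d)

HasCompatibleWith : ∀ {n} → Graph n → Fin n → Fin n → Set₁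
HasCompatibleWith G a b = CompatibleI G a b ⊎ CompatibleII G a b ⊎ CompatibleIII G a b

{-# OPTIONS --safe #-}

-- Since G is 3-connected, H = G ∖ ab is 2-connected, so if H is not internally 3-connected it
-- has a 2-separation (P, Q), say with separator {c, d}. Again by
-- 3-connectivity of G, a and b lie in the interiors of opposite sides. Each separator vertex has
-- a neighbour in both interiors. If it has two neighbours on each side it stays in the
-- separator; otherwise it has a single neighbour w on one side, and we move it to the other side
-- and delete its edge to w. Deleting ab and the edges of the moved vertices leaves a 2-, 1- or
-- 0-separation with a and b on opposite sides: a compatible set of type (iii), (ii) or (i).
-- Super-minimality is used only to decide adjacency, which the case analysis on degrees and the
-- search for a 2-separation require.
module Submission where

open import Data.Bool as Bool using ()
open import Data.Empty using (⊥; ⊥-elim)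
open import Data.Fin using (Fin; _≟_) renaming (zero to fzero; suc to fsuc)
open import Data.Fin.Properties using (any?; all?)
open import Data.Fin.Subset
  using (Subset; _∈_; _∉_; _∪_; _∩_; _-_; ∁; ∣_∣; ⁅_⁆; _⊆_; inside; outside) renaming (⊥ to ∅)
open import Data.Fin.Subset.Properties
open import Data.List using (List; []; _∷_; _++_)
open import Data.List.Membership.Propositional using () renaming (_∈_ to _∈ₗ_)
open import Data.List.Relation.Unary.All using (All; []; _∷_)
import Data.List.Relation.Unary.All as All
import Data.List.Relation.Unary.All.Properties as All
open import Data.List.Relation.Unary.Any using (here; there)
open import Data.Nat as ℕ using (ℕ; suc; _+_; _<_; _≤_; z≤n; s≤s; s≤s⁻¹; _<?_)
open import Data.Nat.Properties
  using (module ≤-Reasoning; +-comm; +-suc; <-trans; ≤-<-trans; <-≤-trans; ≤-trans; ≮⇒≥; n<1+n;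
         ≤-reflexive; <-irrefl; suc-injective)
open import Data.Product using (∃-syntax; _×_; _,_; proj₁; proj₂)
import Data.Product as Product
open import Data.Product.Properties using (≡-dec)
open import Data.Sum using (_⊎_; inj₁; inj₂; [_,_])
import Data.Sum as Sum
open import Data.Vec using (_∷_; here; there)
open import Data.Vec.Properties using () renaming (≡-dec to Vec-≡-dec)
open import Function using (_∘_; id; case_of_)
open import Function.Bundles using (mk⇔; Equivalence)
open import Relation.Binary.Construct.Closure.ReflexiveTransitive
  using (Star; ε; _◅_; _◅◅_) renaming (map to Star-map)
open import Relation.Binary.PropositionalEquality
  using (_≡_; _≢_; refl; sym; trans; cong; subst; module ≡-Reasoning)
open import Relation.Nullary using (¬_; Dec; yes; no)
open import Relation.Nullary.Decidable using (_×-dec_; _⊎-dec_; _→-dec_; ¬?; map′)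

open import Defs

-- Finite subsets

x∈p-y⇒x≢y : ∀ {n} {p : Subset n} {x y} → x ∈ p - y → x ≢ y
x∈p-y⇒x≢y {p = _ ∷ _} {fzero}  {fzero}  ()
x∈p-y⇒x≢y {p = _ ∷ _} {fzero}  {fsuc _} _ ()
x∈p-y⇒x≢y {p = _ ∷ _} {fsuc _} {fzero}  _ ()
x∈p-y⇒x≢y {p = _ ∷ _} {fsuc _} {fsuc _} (there x∈p-y) refl = x∈p-y⇒x≢y x∈p-y refl

x∈p-y⇒x∈p : ∀ {n} {p : Subset n} {x y} → x ∈ p - y → x ∈ p
x∈p-y⇒x∈p {p = p} {y = y} = p─q⊆p p ⁅ y ⁆

∣p∣≡1+∣p-x∣ : ∀ {n} {p : Subset n} {x} → x ∈ p → ∣ p ∣ ≡ suc ∣ p - x ∣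
∣p∣≡1+∣p-x∣ {p = inside  ∷ p} here        = cong suc (cong ∣_∣ (sym (p─⊥≡p p)))
∣p∣≡1+∣p-x∣ {p = inside  ∷ p} (there x∈p) = cong suc (∣p∣≡1+∣p-x∣ x∈p)
∣p∣≡1+∣p-x∣ {p = outside ∷ p} (there x∈p) = ∣p∣≡1+∣p-x∣ x∈p

∉∪⁺ : ∀ {n} {p q : Subset n} {x} → x ∉ p → x ∉ q → x ∉ p ∪ q
∉∪⁺ {p = p} {q} x∉p x∉q x∈p∪q = [ x∉p , x∉q ] (x∈p∪q⁻ p q x∈p∪q)

∣p∪⁅x⁆∣≤1+∣p∣ : ∀ {n} (p : Subset n) x → ∣ p ∪ ⁅ x ⁆ ∣ ≤ suc ∣ p ∣
∣p∪⁅x⁆∣≤1+∣p∣ p x = begin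
  ∣ p ∪ ⁅ x ⁆ ∣         ≡⟨ ∣p∣≡1+∣p-x∣ {p = p ∪ ⁅ x ⁆} (x∈p∪q⁺ (inj₂ (x∈⁅x⁆ x))) ⟩
  suc ∣ p ∪ ⁅ x ⁆ - x ∣ ≤⟨ s≤s (p⊆q⇒∣p∣≤∣q∣ p∪⁅x⁆-x⊆p) ⟩
  suc ∣ p ∣             ∎
  where
  open ≤-Reasoning
  p∪⁅x⁆-x⊆p : p ∪ ⁅ x ⁆ - x ⊆ p
  p∪⁅x⁆-x⊆p y∈ with x∈p∪q⁻ p ⁅ x ⁆ (x∈p-y⇒x∈p y∈)
  ... | inj₁ y∈p = y∈p
  ... | inj₂ y∈⁅x⁆ = ⊥-elim (x∈p-y⇒x≢y y∈ (x∈⁅y⁆⇒x≡y x y∈⁅x⁆))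

x∈p∖q⇒∣p∩q∣<∣p∣ : ∀ {n} {p q : Subset n} {x} → x ∈ p → x ∉ q → ∣ p ∩ q ∣ < ∣ p ∣
x∈p∖q⇒∣p∩q∣<∣p∣ {p = p} {q} {x} x∈p x∉q =
  subst (suc ∣ p ∩ q ∣ ≤_) (sym (∣p∣≡1+∣p-x∣ x∈p)) (s≤s (p⊆q⇒∣p∣≤∣q∣ p∩q⊆p-x))
  where
  p∩q⊆p-x : p ∩ q ⊆ p - x
  p∩q⊆p-x y∈p∩q with y∈p , y∈q ← x∈p∩q⁻ p q y∈p∩q =
    x∈p∧x≢y⇒x∈p-y y∈p (λ { refl → x∉q y∈q })

∣q∣<∣p∣⇒∃p∖q : ∀ {n} {p q : Subset n} → ∣ q ∣ < ∣ p ∣ → ∃[ x ] (x ∈ p × x ∉ q)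
∣q∣<∣p∣⇒∃p∖q {p = p} {q} ∣q∣<∣p∣ with any? (λ x → x ∈? p ×-dec ¬? (x ∈? q))
... | yes p∖q≢∅ = p∖q≢∅
... | no  p∖q≡∅ = ⊥-elim (<-irrefl refl (<-≤-trans ∣q∣<∣p∣ (p⊆q⇒∣p∣≤∣q∣ p⊆q)))
  where
  p⊆q : p ⊆ q
  p⊆q {x} x∈p with x ∈? q
  ... | yes x∈q = x∈q
  ... | no  x∉q = ⊥-elim (p∖q≡∅ (x , x∈p , x∉q))

∣p∩q∣<∣p∣⇒∃p∖q : ∀ {n} {p q : Subset n} → ∣ p ∩ q ∣ < ∣ p ∣ → ∃[ x ] (x ∈ p × x ∉ q)
∣p∩q∣<∣p∣⇒∃p∖q {p = p} {q} ∣p∩q∣<∣p∣ with x , x∈p , x∉p∩q ← ∣q∣<∣p∣⇒∃p∖q ∣p∩q∣<∣p∣ =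
  x , x∈p , λ x∈q → x∉p∩q (x∈p∩q⁺ (x∈p , x∈q))

2≤∣p∣⇒distinct : ∀ {n} {p : Subset n} → 2 ≤ ∣ p ∣ → ∃[ c ] ∃[ d ] (c ≢ d × c ∈ p × d ∈ p)
2≤∣p∣⇒distinct {n} {p} 2≤∣p∣
  with c , c∈p , _ ← ∣q∣<∣p∣⇒∃p∖q {p = p} {q = ∅}
         (subst (_< ∣ p ∣) (sym (∣⊥∣≡0 n)) (≤-trans (s≤s z≤n) 2≤∣p∣))
  with d , d∈p-c , _ ← ∣q∣<∣p∣⇒∃p∖q {p = p - c} {q = ∅}
         (subst (_< ∣ p - c ∣) (sym (∣⊥∣≡0 n)) (s≤s⁻¹ (subst (2 ≤_) (∣p∣≡1+∣p-x∣ c∈p) 2≤∣p∣)))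
  = c , d , (λ c≡d → x∈p-y⇒x≢y d∈p-c (sym c≡d)) , c∈p , x∈p-y⇒x∈p d∈p-c

p-x∩q≡p∩q-x : ∀ {n} (p q : Subset n) x → (p - x) ∩ q ≡ (p ∩ q) - x
p-x∩q≡p∩q-x p q x = ⊆-antisym forth back
  where
  forth : (p - x) ∩ q ⊆ (p ∩ q) - x
  forth y∈ with y∈p-x , y∈q ← x∈p∩q⁻ (p - x) q y∈ =
    x∈p∧x≢y⇒x∈p-y (x∈p∩q⁺ (x∈p-y⇒x∈p y∈p-x , y∈q)) (x∈p-y⇒x≢y y∈p-x)
  back : (p ∩ q) - x ⊆ (p - x) ∩ q
  back y∈ with y∈p , y∈q ← x∈p∩q⁻ p q (x∈p-y⇒x∈p y∈) =
    x∈p∩q⁺ (x∈p∧x≢y⇒x∈p-y y∈p (x∈p-y⇒x≢y y∈) , y∈q)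

∣p∩q∣≡1+∣p-x∩q∣ : ∀ {n} {p q : Subset n} {x} → x ∈ p ∩ q → ∣ p ∩ q ∣ ≡ suc ∣ (p - x) ∩ q ∣
∣p∩q∣≡1+∣p-x∩q∣ {p = p} {q} {x} x∈p∩q =
  trans (∣p∣≡1+∣p-x∣ x∈p∩q) (cong (suc ∘ ∣_∣) (sym (p-x∩q≡p∩q-x p q x)))

∣p∩q∣≡∣q∩p∣ : ∀ {n} (p q : Subset n) → ∣ p ∩ q ∣ ≡ ∣ q ∩ p ∣
∣p∩q∣≡∣q∩p∣ p q = cong ∣_∣ (∩-comm p q)

-- Walks

module _ {A : Set} {R : A → A → Set} where

  walk-exit : ∀ {P : A → Set} → (∀ x → Dec (P x)) → ∀ {s t} → Star R s t → P s → ¬ P t →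
    ∃[ u ] ∃[ v ] (R u v × P u × ¬ P v)
  walk-exit P? ε Ps ¬Pt = ⊥-elim (¬Pt Ps)
  walk-exit P? (_◅_ {j = m} r w) Ps ¬Pt with P? m
  ... | yes Pm = walk-exit P? w Pm ¬Pt
  ... | no ¬Pm = _ , _ , r , Ps , ¬Pm

  walkSteps : ∀ {s t} → Star R s t → List (A × A)
  walkSteps ε = []
  walkSteps (_◅_ {i} {j} _ w) = (i , j) ∷ walkSteps w

  ∈-walkSteps⇒R : ∀ {s t u v} (w : Star R s t) → (u , v) ∈ₗ walkSteps w → R u v
  ∈-walkSteps⇒R (r ◅ w) (here refl) = r
  ∈-walkSteps⇒R (r ◅ w) (there uv∈) = ∈-walkSteps⇒R w uv∈

  map-walkSteps : ∀ {R′ : A → A → Set} {s t} (w : Star R s t) →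
    (∀ {u v} → (u , v) ∈ₗ walkSteps w → R′ u v) → Star R′ s t
  map-walkSteps ε f = ε
  map-walkSteps (r ◅ w) f = f (here refl) ◅ map-walkSteps w (f ∘ there)

-- Minimally k-connected graphs

-- Fix one walk for every admissible (X, s, t). The edges these walks use form a k-connected
-- spanning subgraph, so by minimality they are all the edges of G; and being an edge of one of
-- finitely many listed walks is decidable.
module MinimallyConnected {n k} (G : Graph n) (k-conn : KConnected k G)
                          (minimal : ∀ H → H <G G → ¬ KConnected k H) where

  chosenSteps′ : ∀ X s t → Dec (∣ X ∣ < k) → Dec (s ∈ V (G ─ X)) → Dec (t ∈ V (G ─ X)) →
    List (Fin n × Fin n)
  chosenSteps′ X s t (yes ∣X∣<k) (yes s∈) (yes t∈) = walkSteps (proj₂ k-conn X ∣X∣<k s∈ t∈)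
  chosenSteps′ _ _ _ _ _ _ = []

  chosenSteps : Subset n → Fin n → Fin n → List (Fin n × Fin n)
  chosenSteps X s t = chosenSteps′ X s t (∣ X ∣ <? k) (s ∈? V (G ─ X)) (t ∈? V (G ─ X))

  Used : Fin n → Fin n → Set
  Used u v = ∃[ X ] ∃[ s ] ∃[ t ] (u , v) ∈ₗ chosenSteps X s t

  used? : ∀ u v → Dec (Used u v)
  used? u v = anySubset? λ X → any? λ s → any? λ t → (u , v) ∈ₗ? chosenSteps X s t
    where
    open import Data.List.Membership.DecPropositional (≡-dec _≟_ _≟_)
      using () renaming (_∈?_ to _∈ₗ?_)

  used⇒E : ∀ {u v} → Used u v → E G u v
  used⇒E {u} {v} (X , s , t , uv∈) = go (∣ X ∣ <? k) (s ∈? V (G ─ X)) (t ∈? V (G ─ X)) uv∈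
    where
    go : ∀ dk ds dt → (u , v) ∈ₗ chosenSteps′ X s t dk ds dt → E G u v
    go (yes ∣X∣<k) (yes s∈) (yes t∈) uv∈ = proj₁ (∈-walkSteps⇒R (proj₂ k-conn X ∣X∣<k s∈ t∈) uv∈)
    go (no _)  _       _       ()
    go (yes _) (no _)  _       ()
    go (yes _) (yes _) (no _)  ()

  usedGraph : Graph n
  usedGraph = record
    { V     = V G
    ; E     = λ u v → Used u v ⊎ Used v u
    ; E-sym = λ { (inj₁ uv) → inj₂ uv ; (inj₂ vu) → inj₁ vu }
    ; E-irr = λ { (inj₁ vv) → E-irr G (used⇒E vv) ; (inj₂ vv) → E-irr G (used⇒E vv) }
    ; E-V   = λ { (inj₁ uv) → E-V G (used⇒E uv) ; (inj₂ vu) → E-V G (E-sym G (used⇒E vu)) }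
    }

  usedGraph-connected : KConnected k usedGraph
  usedGraph-connected = proj₁ k-conn , λ X ∣X∣<k {s} {t} s∈ t∈ →
    chosen X s t (∣ X ∣ <? k) (s ∈? V (G ─ X)) (t ∈? V (G ─ X)) ∣X∣<k s∈ t∈
      (λ uv∈ → inj₁ (X , s , t , uv∈))
    where
    chosen : ∀ X s t dk ds dt → ∣ X ∣ < k → s ∈ V (G ─ X) → t ∈ V (G ─ X) →
      (∀ {u v} → (u , v) ∈ₗ chosenSteps′ X s t dk ds dt → E usedGraph u v) →
      Star (E (usedGraph ─ X)) s t
    chosen X s t (yes ∣X∣<k) (yes s∈) (yes t∈) _ _ _ used =
      map-walkSteps w λ uv∈ → used uv∈ , proj₂ (∈-walkSteps⇒R w uv∈)
      where w = proj₂ k-conn X ∣X∣<k s∈ t∈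
    chosen X s t (no ∣X∣≮k) _ _ ∣X∣<k _ _ _ = ⊥-elim (∣X∣≮k ∣X∣<k)
    chosen X s t (yes _) (no s∉) _ _ s∈ _ _ = ⊥-elim (s∉ s∈)
    chosen X s t (yes _) (yes _) (no t∉) _ _ t∈ _ = ⊥-elim (t∉ t∈)

  E? : ∀ u v → Dec (E G u v)
  E? u v with used? u v | used? v u
  ... | yes uv | _      = yes (used⇒E uv)
  ... | no _   | yes vu = yes (E-sym G (used⇒E vu))
  ... | no ¬uv | no ¬vu = no λ uv → minimal usedGraph
    ((id , [ used⇒E , E-sym G ∘ used⇒E ]) , inj₂ (u , v , uv , [ ¬uv , ¬vu ]))
    usedGraph-connected

-- Deleting edges

SameEdge? : ∀ {n} (u v a b : Fin n) → Dec (SameEdge u v a b)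
SameEdge? u v a b = (u ≟ a ×-dec v ≟ b) ⊎-dec (u ≟ b ×-dec v ≟ a)

∖E-dec : ∀ {n} (G : Graph n) → (∀ u v → Dec (E G u v)) → ∀ es u v → Dec (E (G ∖E es) u v)
∖E-dec G E? es u v = E? u v ×-dec All.all? (λ (a , b) → ¬? (SameEdge? u v a b)) es

module _ {n} {G : Graph n} {X : Subset n} {x : Fin n} where

  ∈V─⁺ : x ∈ V G → x ∉ X → x ∈ V (G ─ X)
  ∈V─⁺ x∈V x∉X = x∈p∩q⁺ (x∈V , x∉p⇒x∈∁p x∉X)

  ∈V─⁻ : x ∈ V (G ─ X) → x ∈ V G × x ∉ X
  ∈V─⁻ x∈ with x∈V , x∈∁X ← x∈p∩q⁻ (V G) (∁ X) x∈ = x∈V , x∈∁p⇒x∉p x∈∁X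

module _ {n k} (G : Graph n) {a b : Fin n} (a≢b : a ≢ b) (conn : KConnected (suc k) G) where

  private
    H = G ∖E ((a , b) ∷ [])

    lift : ∀ {X z s t} → z ≡ a ⊎ z ≡ b → Star (E (G ─ (X ∪ ⁅ z ⁆))) s t → Star (E (H ─ X)) s t
    lift {X} {z} z∈ab = Star-map λ (uv , u∉ , v∉) →
      (uv , avoids-z u∉ v∉ ∷ []) ,
      (λ u∈X → u∉ (x∈p∪q⁺ (inj₁ u∈X))) , (λ v∈X → v∉ (x∈p∪q⁺ (inj₁ v∈X)))
      where
      z∉ : ∀ {y} → y ∉ X ∪ ⁅ z ⁆ → y ≢ z
      z∉ y∉ refl = y∉ (x∈p∪q⁺ (inj₂ (x∈⁅x⁆ _)))
      avoids-z : ∀ {u v} → u ∉ X ∪ ⁅ z ⁆ → v ∉ X ∪ ⁅ z ⁆ → ¬ SameEdge u v a b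
      avoids-z u∉ v∉ (inj₁ (refl , refl)) = [ z∉ u∉ ∘ sym , z∉ v∉ ∘ sym ] z∈ab
      avoids-z u∉ v∉ (inj₂ (refl , refl)) = [ z∉ v∉ ∘ sym , z∉ u∉ ∘ sym ] z∈ab

    avoiding : ∀ {X} → ∣ X ∣ < k → ∀ {z s t} → z ≡ a ⊎ z ≡ b →
      s ∈ V G → s ∉ X → s ≢ z → t ∈ V G → t ∉ X → t ≢ z → Star (E (H ─ X)) s t
    avoiding {X} ∣X∣<k {z} z∈ab s∈V s∉X s≢z t∈V t∉X t≢z = lift z∈ab (proj₂ conn (X ∪ ⁅ z ⁆)
      (s≤s (≤-trans (∣p∪⁅x⁆∣≤1+∣p∣ X z) ∣X∣<k))
      (∈V─⁺ {G = G} s∈V (∉∪⁺ s∉X (x≢y⇒x∉⁅y⁆ s≢z)))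
      (∈V─⁺ {G = G} t∈V (∉∪⁺ t∉X (x≢y⇒x∉⁅y⁆ t≢z))))

    other-end : ∀ u → ∃[ z ] ((z ≡ a ⊎ z ≡ b) × u ≢ z)
    other-end u with u ≟ a
    ... | no u≢a   = a , inj₁ refl , u≢a
    ... | yes refl = b , inj₂ refl , a≢b

    X∪ab-small : ∀ {X} → ∣ X ∣ < k → ∣ (X ∪ ⁅ a ⁆) ∪ ⁅ b ⁆ ∣ < ∣ V G ∣
    X∪ab-small {X} ∣X∣<k = ≤-<-trans (≤-trans (∣p∪⁅x⁆∣≤1+∣p∣ (X ∪ ⁅ a ⁆) b)
      (s≤s (≤-trans (∣p∪⁅x⁆∣≤1+∣p∣ X a) ∣X∣<k))) (proj₁ conn)

  -- Every vertex is joined to a vertex w outside X ∪ {a, b} while avoiding one end of ab.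
  ∖E-connected : KConnected k (G ∖E ((a , b) ∷ []))
  ∖E-connected = <-trans (n<1+n k) (proj₁ conn) , connected
    where
    connected : ∀ X → ∣ X ∣ < k → Connected (H ─ X)
    connected X ∣X∣<k {u} {v} u∈ v∈
      with u∈V , u∉X ← ∈V─⁻ {G = G} u∈ | v∈V , v∉X ← ∈V─⁻ {G = G} v∈
      with w , w∈V , w∉X∪ab
           ← ∣q∣<∣p∣⇒∃p∖q {p = V G} {q = (X ∪ ⁅ a ⁆) ∪ ⁅ b ⁆} (X∪ab-small {X} ∣X∣<k)
      with z , z∈ab , u≢z ← other-end u | z′ , z′∈ab , v≢z′ ← other-end v
      = avoiding ∣X∣<k z∈ab u∈V u∉X u≢z w∈V w∉X (w≢ z∈ab) ◅◅
        avoiding ∣X∣<k z′∈ab w∈V w∉X (w≢ z′∈ab) v∈V v∉X v≢z′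
      where
      w∉X : w ∉ X
      w∉X w∈X = w∉X∪ab (x∈p∪q⁺ (inj₁ (x∈p∪q⁺ (inj₁ w∈X))))
      w≢ : ∀ {z} → z ≡ a ⊎ z ≡ b → w ≢ z
      w≢ (inj₁ refl) refl = w∉X∪ab (x∈p∪q⁺ (inj₁ (x∈p∪q⁺ (inj₂ (x∈⁅x⁆ w)))))
      w≢ (inj₂ refl) refl = w∉X∪ab (x∈p∪q⁺ (inj₂ (x∈⁅x⁆ w)))

-- Splits: vertex sets of separations

record Split {n} (K : Graph n) (P Q : Subset n) : Set where
  field
    covers      : P ∪ Q ≡ V K
    edge-inside : ∀ {u v} → E K u v → (u ∈ P × v ∈ P) ⊎ (u ∈ Q × v ∈ Q)

  ∈V⇒∈P⊎Q : ∀ {x} → x ∈ V K → x ∈ P ⊎ x ∈ Q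
  ∈V⇒∈P⊎Q x∈V = x∈p∪q⁻ P Q (subst (_ ∈_) (sym covers) x∈V)

  ∈P⊎Q⇒∈V : ∀ {x} → x ∈ P ⊎ x ∈ Q → x ∈ V K
  ∈P⊎Q⇒∈V x∈P⊎Q = subst (_ ∈_) covers (x∈p∪q⁺ x∈P⊎Q)

  ∉Q⇒∈P : ∀ {x} → x ∈ V K → x ∉ Q → x ∈ P
  ∉Q⇒∈P x∈V x∉Q = [ id , ⊥-elim ∘ x∉Q ] (∈V⇒∈P⊎Q x∈V)

  ∉P⇒∈Q : ∀ {x} → x ∈ V K → x ∉ P → x ∈ Q
  ∉P⇒∈Q x∈V x∉P = [ ⊥-elim ∘ x∉P , id ] (∈V⇒∈P⊎Q x∈V)
open Split

module _ {n} {K : Graph n} {P Q : Subset n} where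

  Split-swap : Split K P Q → Split K Q P
  Split-swap split = record
    { covers      = trans (∪-comm Q P) (covers split)
    ; edge-inside = Sum.swap ∘ edge-inside split
    }

  Split-mono : ∀ {K′ : Graph n} → V K′ ≡ V K → (∀ {u v} → E K′ u v → E K u v) →
    Split K P Q → Split K′ P Q
  Split-mono V≡ E⊆ split = record
    { covers      = trans (covers split) (sym V≡)
    ; edge-inside = edge-inside split ∘ E⊆
    }

  Split-retract : ∀ {z} → Split K P Q → z ∈ Q → (∀ {x} → E K z x → x ∈ P → x ∉ Q → ⊥) →
    Split K (P - z) Q
  Split-retract {z} split z∈Q no-edge = record
    { covers      = trans P-z∪Q≡P∪Q (covers split)
    ; edge-inside = retracted-edge
    }
    where
    P-z∪Q≡P∪Q : (P - z) ∪ Q ≡ P ∪ Q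
    P-z∪Q≡P∪Q = ⊆-antisym
      (λ x∈ → x∈p∪q⁺ (Sum.map₁ x∈p-y⇒x∈p (x∈p∪q⁻ (P - z) Q x∈)))
      (λ {x} x∈ → x∈p∪q⁺ (case x∈p∪q⁻ P Q x∈ of λ where
        (inj₂ x∈Q) → inj₂ x∈Q
        (inj₁ x∈P) → case x ≟ z of λ where
          (yes refl) → inj₂ z∈Q
          (no x≢z)   → inj₁ (x∈p∧x≢y⇒x∈p-y x∈P x≢z)))
    kept : ∀ {x y} → E K x y → x ∈ P → x ∉ Q → y ∈ P → x ∈ P - z × y ∈ P - z
    kept xy x∈P x∉Q y∈P =
      x∈p∧x≢y⇒x∈p-y x∈P (λ { refl → x∉Q z∈Q }) ,
      x∈p∧x≢y⇒x∈p-y y∈P (λ { refl → no-edge (E-sym K xy) x∈P x∉Q })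
    retracted-edge : ∀ {u v} → E K u v → (u ∈ P - z × v ∈ P - z) ⊎ (u ∈ Q × v ∈ Q)
    retracted-edge {u} {v} uv with edge-inside split uv | u ∈? Q | v ∈? Q
    ... | inj₂ u,v∈Q        | _       | _       = inj₂ u,v∈Q
    ... | inj₁ _            | yes u∈Q | yes v∈Q = inj₂ (u∈Q , v∈Q)
    ... | inj₁ (u∈P , v∈P) | no u∉Q  | _       = inj₁ (kept uv u∈P u∉Q v∈P)
    ... | inj₁ (u∈P , v∈P) | _       | no v∉Q  = inj₁ (Product.swap (kept (E-sym K uv) v∈P v∉Q u∈P))

module _ {n} (K : Graph n) where

  -- Edges with both ends in P ∩ Q are assigned to the Q side.
  sideP : Subset n → Subset n → Graph n
  sideP P Q = record
    { V     = P
    ; E     = λ u v → E K u v × (u ∈ P × v ∈ P) × ¬ (u ∈ Q × v ∈ Q)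
    ; E-sym = λ (uv , (u∈P , v∈P) , ¬inQ) → E-sym K uv , (v∈P , u∈P) , ¬inQ ∘ Product.swap
    ; E-irr = E-irr K ∘ proj₁
    ; E-V   = proj₁ ∘ proj₁ ∘ proj₂
    }

  sideQ : Subset n → Graph n
  sideQ Q = record
    { V     = Q
    ; E     = λ u v → E K u v × (u ∈ Q × v ∈ Q)
    ; E-sym = λ (uv , (u∈Q , v∈Q)) → E-sym K uv , (v∈Q , u∈Q)
    ; E-irr = E-irr K ∘ proj₁
    ; E-V   = proj₁ ∘ proj₂
    }

  Split⇒KSep : ∀ {P Q k x y} → Split K P Q → ∣ P ∩ Q ∣ ≡ k →
    x ∈ P → x ∉ Q → y ∈ Q → y ∉ P → KSep k K
  Split⇒KSep {P} {Q} split ∣P∩Q∣≡k x∈P x∉Q y∈Q y∉P = record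
    { A        = sideP P Q
    ; B        = sideQ Q
    ; union-V  = covers split
    ; union-E  = mk⇔ to [ proj₁ , proj₁ ]
    ; disjoint = λ ((_ , _ , ¬inQ) , (_ , inQ)) → ¬inQ inQ
    ; meet     = ∣P∩Q∣≡k
    ; bigA     = subst (_< ∣ P ∣) ∣P∩Q∣≡k (x∈p∖q⇒∣p∩q∣<∣p∣ x∈P x∉Q)
    ; bigB     = subst (_< ∣ Q ∣) (trans (∣p∩q∣≡∣q∩p∣ Q P) ∣P∩Q∣≡k) (x∈p∖q⇒∣p∩q∣<∣p∣ y∈Q y∉P)
    }
    where
    to : ∀ {u v} → E K u v → E (sideP P Q) u v ⊎ E (sideQ Q) u v
    to {u} {v} uv with u ∈? Q ×-dec v ∈? Q | edge-inside split uv
    ... | yes inQ | _        = inj₂ (uv , inQ)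
    ... | no ¬inQ | inj₁ inP = inj₁ (uv , inP , ¬inQ)
    ... | no ¬inQ | inj₂ inQ = ⊥-elim (¬inQ inQ)

  KSep⇒Split : ∀ {k} (S : KSep k K) → Split K (V (A S)) (V (B S))
  KSep⇒Split S = record
    { covers      = union-V S
    ; edge-inside = λ uv → Sum.map (ends {G = A S}) (ends {G = B S}) (Equivalence.to (union-E S) uv)
    }
    where
    ends : ∀ {G : Graph n} {u v} → E G u v → u ∈ V G × v ∈ V G
    ends {G} uv = E-V G uv , E-V G (E-sym G uv)

  split? : (∀ u v → Dec (E K u v)) → ∀ P Q → Dec (Split K P Q)
  split? E? P Q = map′ (λ (c , e) → record { covers = c ; edge-inside = λ {u} {v} → e u v })
                       (λ split → covers split , λ u v → edge-inside split)
    (Vec-≡-dec Bool._≟_ (P ∪ Q) (V K) ×-dec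
     all? λ u → all? λ v → E? u v →-dec ((u ∈? P ×-dec v ∈? P) ⊎-dec (u ∈? Q ×-dec v ∈? Q)))

module _ {n} {K : Graph n} {P Q : Subset n} (split : Split K P Q) where

  split-exit : ∀ {X x y} → Star (E (K ─ X)) x y → x ∈ P → x ∉ Q → y ∉ P →
    ∃[ u ] ∃[ v ] (E K u v × u ∈ P × u ∉ Q × v ∈ P ∩ Q × v ∉ X)
  split-exit w x∈P x∉Q y∉P
    with u , v , (uv , _ , v∉X) , (u∈P , u∉Q) , ¬v∈P∖Q
         ← walk-exit (λ x → x ∈? P ×-dec ¬? (x ∈? Q)) w (x∈P , x∉Q) (y∉P ∘ proj₁)
    with edge-inside split uv | v ∈? Q
  ... | inj₂ (u∈Q , _) | _       = ⊥-elim (u∉Q u∈Q)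
  ... | inj₁ (_ , v∈P) | no v∉Q  = ⊥-elim (¬v∈P∖Q (v∈P , v∉Q))
  ... | inj₁ (_ , v∈P) | yes v∈Q = u , v , uv , u∈P , u∉Q , x∈p∩q⁺ (v∈P , v∈Q) , v∉X

  module _ {k} (conn : KConnected k K) {x y}
           (x∈P : x ∈ P) (x∉Q : x ∉ Q) (y∈Q : y ∈ Q) (y∉P : y ∉ P) where

    private
      walk : ∀ {X} → ∣ X ∣ < k → x ∉ X → y ∉ X → Star (E (K ─ X)) x y
      walk ∣X∣<k x∉X y∉X = proj₂ conn _ ∣X∣<k
        (∈V─⁺ {G = K} (∈P⊎Q⇒∈V split (inj₁ x∈P)) x∉X) (∈V─⁺ {G = K} (∈P⊎Q⇒∈V split (inj₂ y∈Q)) y∉X)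

      x∉P∩Q : x ∉ P ∩ Q
      x∉P∩Q = x∉Q ∘ proj₂ ∘ x∈p∩q⁻ P Q

      y∉P∩Q : y ∉ P ∩ Q
      y∉P∩Q = y∉P ∘ proj₁ ∘ x∈p∩q⁻ P Q

    k≤∣P∩Q∣ : k ≤ ∣ P ∩ Q ∣
    k≤∣P∩Q∣ with ∣ P ∩ Q ∣ <? k
    ... | no ∣P∩Q∣≮k = ≮⇒≥ ∣P∩Q∣≮k
    ... | yes ∣P∩Q∣<k
      with _ , _ , _ , _ , _ , v∈P∩Q , v∉P∩Q
           ← split-exit (walk ∣P∩Q∣<k x∉P∩Q y∉P∩Q) x∈P x∉Q y∉P
      = ⊥-elim (v∉P∩Q v∈P∩Q)

    separator-neighbour : ∣ P ∩ Q ∣ ≤ k → ∀ {z} → z ∈ P ∩ Q → ∃[ u ] (u ∈ P × u ∉ Q × E K z u)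
    separator-neighbour ∣P∩Q∣≤k {z} z∈P∩Q
      with u , v , uv , u∈P , u∉Q , v∈P∩Q , v∉P∩Q-z
           ← split-exit (walk (subst (_≤ k) (∣p∣≡1+∣p-x∣ z∈P∩Q) ∣P∩Q∣≤k)
                              (x∉P∩Q ∘ x∈p-y⇒x∈p) (y∉P∩Q ∘ x∈p-y⇒x∈p)) x∈P x∉Q y∉P
      with v ≟ z
    ... | yes refl = u , u∈P , u∉Q , E-sym K uv
    ... | no v≢z   = ⊥-elim (v∉P∩Q-z (x∈p∧x≢y⇒x∈p-y v∈P∩Q v≢z))

Split-∖E⁻ : ∀ {n} {G : Graph n} {a b P Q} → Split (G ∖E ((a , b) ∷ [])) P Q →
  (a ∈ P × b ∈ P) ⊎ (a ∈ Q × b ∈ Q) → Split G P Q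
Split-∖E⁻ {a = a} {b} split ab-inside = record
  { covers      = covers split
  ; edge-inside = λ {u} {v} uv → case SameEdge? u v a b of λ where
      (yes (inj₁ (refl , refl))) → ab-inside
      (yes (inj₂ (refl , refl))) → Sum.map Product.swap Product.swap ab-inside
      (no ¬ab)                   → edge-inside split (uv , ¬ab ∷ [])
  }

-- Moving separator vertices

Deg≥2-mono : ∀ {n} {A A′ : Graph n} {z} → (∀ {x} → E A z x → E A′ z x) → Deg≥2 A z → Deg≥2 A′ z
Deg≥2-mono A⊆A′ (u , v , u≢v , zu , zv) = u , v , u≢v , A⊆A′ zu , A⊆A′ zv

module SeparatorMoves {n} (G : Graph n) {a b : Fin n}
  (H-conn : KConnected 2 (G ∖E ((a , b) ∷ []))) (E?H : ∀ u v → Dec (E (G ∖E ((a , b) ∷ [])) u v))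
  {P Q : Subset n} (split : Split (G ∖E ((a , b) ∷ [])) P Q)
  (∣P∩Q∣≡2 : ∣ P ∩ Q ∣ ≡ 2) (a∈P : a ∈ P) (a∉Q : a ∉ Q) (b∈Q : b ∈ Q) (b∉P : b ∉ P) where

  H : Graph n
  H = G ∖E ((a , b) ∷ [])

  ∣P∩Q∣≤2 : ∣ P ∩ Q ∣ ≤ 2
  ∣P∩Q∣≤2 = ≤-reflexive ∣P∩Q∣≡2

  ∣Q∩P∣≤2 : ∣ Q ∩ P ∣ ≤ 2
  ∣Q∩P∣≤2 = ≤-reflexive (trans (∣p∩q∣≡∣q∩p∣ Q P) ∣P∩Q∣≡2)

  -- z moves to Q (P) when its neighbour w in the interior of P (in Q) is unique; xy is the deleted
  -- edge, x on the P side. Since edges inside P ∩ Q belong to the Q side, uniqueness for a move to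
  -- P ranges over all of Q: such a vertex has no neighbour left in P ∩ Q.
  data Move (z : Fin n) : Fin n → Fin n → Set where
    toQ : ∀ {w} → w ∈ P → w ∉ Q → E G w z → (∀ {x} → E H z x → x ∈ P → x ∉ Q → x ≡ w) → Move z w z
    toP : ∀ {w} → w ∈ Q → w ∉ P → E G z w → (∀ {x} → E H z x → x ∈ Q → x ≡ w) → Move z z w

  data Fate (z : Fin n) : Set where
    stays : Deg≥2 (sideP H P Q) z → Deg≥2 (sideQ H Q) z → Fate z
    moves : ∀ {x y} → Move z x y → Fate z

  fate : ∀ {z} → z ∈ P → z ∈ Q → Fate z
  fate {z} z∈P z∈Q
    with wP , wP∈P , wP∉Q , zwP
           ← separator-neighbour split H-conn a∈P a∉Q b∈Q b∉P ∣P∩Q∣≤2 (x∈p∩q⁺ (z∈P , z∈Q))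
       | wQ , wQ∈Q , wQ∉P , zwQ
           ← separator-neighbour (Split-swap split) H-conn b∈Q b∉P a∈P a∉Q ∣Q∩P∣≤2
               (x∈p∩q⁺ (z∈Q , z∈P))
    with any? (λ x → ¬? (x ≟ wP) ×-dec E?H z x ×-dec x ∈? P ×-dec ¬? (x ∈? Q))
       | any? (λ x → ¬? (x ≟ wQ) ×-dec E?H z x ×-dec x ∈? Q)
  ... | yes (x , x≢wP , zx , x∈P , x∉Q) | yes (y , y≢wQ , zy , y∈Q) =
    stays (x , wP , x≢wP , (zx , (z∈P , x∈P) , x∉Q ∘ proj₂) , (zwP , (z∈P , wP∈P) , wP∉Q ∘ proj₂))
          (y , wQ , y≢wQ , (zy , z∈Q , y∈Q) , (zwQ , z∈Q , wQ∈Q))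
  ... | no ¬second | _ = moves (toQ wP∈P wP∉Q (E-sym G (proj₁ zwP)) unique)
    where
    unique : ∀ {x} → E H z x → x ∈ P → x ∉ Q → x ≡ wP
    unique {x} zx x∈P x∉Q with x ≟ wP
    ... | yes x≡wP = x≡wP
    ... | no x≢wP  = ⊥-elim (¬second (x , x≢wP , zx , x∈P , x∉Q))
  ... | yes _ | no ¬second = moves (toP wQ∈Q wQ∉P (proj₁ zwQ) unique)
    where
    unique : ∀ {x} → E H z x → x ∈ Q → x ≡ wQ
    unique {x} zx x∈Q with x ≟ wQ
    ... | yes x≡wQ = x≡wQ
    ... | no x≢wQ  = ⊥-elim (¬second (x , x≢wQ , zx , x∈Q))

  shiftP : ∀ {z} → Fate z → Subset n → Subset n
  shiftP {z} (moves (toQ _ _ _ _)) R = R - z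
  shiftP _                         R = R

  shiftQ : ∀ {z} → Fate z → Subset n → Subset n
  shiftQ {z} (moves (toP _ _ _ _)) R = R - z
  shiftQ _                         R = R

  deleted : ∀ {z} → Fate z → List (Fin n × Fin n)
  deleted (stays _ _)       = []
  deleted (moves {x} {y} _) = (x , y) ∷ []

  stayCount : ∀ {z} → Fate z → ℕ
  stayCount (stays _ _) = 1
  stayCount (moves _)   = 0

  module _ {z : Fin n} {R : Subset n} where

    shiftP⊆ : (f : Fate z) → shiftP f R ⊆ R
    shiftP⊆ (stays _ _)              = id
    shiftP⊆ (moves (toQ _ _ _ _))    = x∈p-y⇒x∈p
    shiftP⊆ (moves (toP _ _ _ _))    = id

    shiftQ⊆ : (f : Fate z) → shiftQ f R ⊆ R
    shiftQ⊆ (stays _ _)              = id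
    shiftQ⊆ (moves (toQ _ _ _ _))    = id
    shiftQ⊆ (moves (toP _ _ _ _))    = x∈p-y⇒x∈p

    ∈shiftP⁺ : ∀ (f : Fate z) {x} → x ∈ R → x ≢ z → x ∈ shiftP f R
    ∈shiftP⁺ (stays _ _)           x∈R _   = x∈R
    ∈shiftP⁺ (moves (toQ _ _ _ _)) x∈R x≢z = x∈p∧x≢y⇒x∈p-y x∈R x≢z
    ∈shiftP⁺ (moves (toP _ _ _ _)) x∈R _   = x∈R

    ∈shiftQ⁺ : ∀ (f : Fate z) {x} → x ∈ R → x ≢ z → x ∈ shiftQ f R
    ∈shiftQ⁺ (stays _ _)           x∈R _   = x∈R
    ∈shiftQ⁺ (moves (toQ _ _ _ _)) x∈R _   = x∈R
    ∈shiftQ⁺ (moves (toP _ _ _ _)) x∈R x≢z = x∈p∧x≢y⇒x∈p-y x∈R x≢z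

    ∈shiftQ-neighbour : ∀ (f : Fate z) {x y} → x ∈ R → E H y x → y ∈ P → y ∈ Q → x ∈ shiftQ f R
    ∈shiftQ-neighbour f@(moves (toP w∈Q w∉P _ unique)) {x} x∈R yx y∈P y∈Q with x ≟ z
    ... | yes refl = ⊥-elim (w∉P (subst (_∈ P) (unique (E-sym H yx) y∈Q) y∈P))
    ... | no x≢z   = ∈shiftQ⁺ f x∈R x≢z
    ∈shiftQ-neighbour f@(stays _ _)           x∈R _ _ _ = x∈R
    ∈shiftQ-neighbour f@(moves (toQ _ _ _ _)) x∈R _ _ _ = x∈R

  shift-card : ∀ {z} (f : Fate z) {P₁ Q₁} → z ∈ P₁ ∩ Q₁ →
    stayCount f + ∣ P₁ ∩ Q₁ ∣ ≡ suc ∣ shiftP f P₁ ∩ shiftQ f Q₁ ∣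
  shift-card (stays _ _)           z∈ = refl
  shift-card (moves (toQ _ _ _ _)) z∈ = ∣p∩q∣≡1+∣p-x∩q∣ z∈
  shift-card {z} (moves (toP _ _ _ _)) {P₁} {Q₁} z∈ = begin
    ∣ P₁ ∩ Q₁ ∣           ≡⟨ ∣p∩q∣≡∣q∩p∣ P₁ Q₁ ⟩
    ∣ Q₁ ∩ P₁ ∣           ≡⟨ ∣p∩q∣≡1+∣p-x∩q∣ (x∈p∩q⁺ (Product.swap (x∈p∩q⁻ P₁ Q₁ z∈))) ⟩
    suc ∣ (Q₁ - z) ∩ P₁ ∣ ≡⟨ cong suc (∣p∩q∣≡∣q∩p∣ (Q₁ - z) P₁) ⟩
    suc ∣ P₁ ∩ (Q₁ - z) ∣ ∎
    where open ≡-Reasoning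

  Avoids : Fin n → Fin n → Fin n × Fin n → Set
  Avoids u v e = ¬ SameEdge u v (proj₁ e) (proj₂ e)

  shift-split : ∀ {z} (f : Fate z) {K : Graph n} {P₁ Q₁} →
    (∀ {u v} → E K u v → E H u v) → (∀ {u v} → E K u v → All (Avoids u v) (deleted f)) →
    Split K P₁ Q₁ → z ∈ P₁ → z ∈ Q₁ → P₁ ⊆ P → Q₁ ⊆ Q → (∀ {x} → x ∈ Q → E H z x → x ∈ Q₁) →
    Split K (shiftP f P₁) (shiftQ f Q₁)
  shift-split (stays _ _) _ _ split₁ _ _ _ _ _ = split₁
  shift-split {z} (moves (toQ _ _ _ unique)) {K} {P₁} {Q₁} K⊆H avoids split₁ _ z∈Q₁ P₁⊆P _ Q⊆Q₁ =
    Split-retract split₁ z∈Q₁ no-edge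
    where
    no-edge : ∀ {x} → E K z x → x ∈ P₁ → x ∉ Q₁ → ⊥
    no-edge {x} zx x∈P₁ x∉Q₁ with x ∈? Q
    ... | yes x∈Q = x∉Q₁ (Q⊆Q₁ x∈Q (K⊆H zx))
    ... | no x∉Q with refl ← unique (K⊆H zx) (P₁⊆P x∈P₁) x∉Q =
      All.head (avoids zx) (inj₂ (refl , refl))
  shift-split {z} (moves (toP _ _ _ unique)) {K} {P₁} {Q₁} K⊆H avoids split₁ z∈P₁ _ _ Q₁⊆Q _ =
    Split-swap (Split-retract (Split-swap split₁) z∈P₁ no-edge)
    where
    no-edge : ∀ {x} → E K z x → x ∈ Q₁ → x ∉ P₁ → ⊥
    no-edge {x} zx x∈Q₁ _ with refl ← unique (K⊆H zx) (Q₁⊆Q x∈Q₁) =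
      All.head (avoids zx) (inj₁ (refl , refl))

  separator-avoids-ab : ∀ {u v} → u ∈ P → u ∈ Q → Avoids u v (a , b)
  separator-avoids-ab u∈P u∈Q (inj₁ (refl , _)) = a∉Q u∈Q
  separator-avoids-ab u∈P u∈Q (inj₂ (refl , _)) = b∉P u∈P

  separator-avoids : ∀ {z} (f : Fate z) {u v} → u ∈ P → u ∈ Q → u ≢ z → All (Avoids u v) (deleted f)
  separator-avoids (stays _ _)                 _   _   _   = []
  separator-avoids (moves (toQ _ w∉Q _ _)) u∈P u∈Q u≢z =
    [ (λ (u≡w , _) → w∉Q (subst (_∈ Q) u≡w u∈Q)) , u≢z ∘ proj₁ ] ∷ []
  separator-avoids (moves (toP _ w∉P _ _)) u∈P u∈Q u≢z =
    [ u≢z ∘ proj₁ , (λ (u≡w , _) → w∉P (subst (_∈ P) u≡w u∈P)) ] ∷ []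

  move-avoids-ab : ∀ {z x y} → Move z x y → z ∈ P → z ∈ Q → ¬ SameEdge a b x y
  move-avoids-ab (toQ _ _ _ _) z∈P z∈Q (inj₁ (_ , refl)) = b∉P z∈P
  move-avoids-ab (toQ _ _ _ _) z∈P z∈Q (inj₂ (refl , _)) = a∉Q z∈Q
  move-avoids-ab (toP _ _ _ _) z∈P z∈Q (inj₁ (refl , _)) = a∉Q z∈Q
  move-avoids-ab (toP _ _ _ _) z∈P z∈Q (inj₂ (_ , refl)) = b∉P z∈P

  move-edge : ∀ {z x y} → Move z x y → E G x y
  move-edge (toQ _ _ wz _) = wz
  move-edge (toP _ _ zw _) = zw

  moves-distinct : ∀ {c d x y x′ y′} → Move c x y → Move d x′ y′ → c ∈ P → c ∈ Q → c ≢ d →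
    ¬ SameEdge x y x′ y′
  moves-distinct (toQ _ _ _ _) m′ c∈P c∈Q c≢d same =
    All.head (separator-avoids (moves m′) c∈P c∈Q c≢d) (SameEdge-sym same)
  moves-distinct (toP _ _ _ _) m′ c∈P c∈Q c≢d same =
    All.head (separator-avoids (moves m′) c∈P c∈Q c≢d) same

  record SeparatorPair (z z′ : Fin n) : Set where
    field
      z≢z′ : z ≢ z′
      z∈P  : z ∈ P
      z∈Q  : z ∈ Q
      z′∈P : z′ ∈ P
      z′∈Q : z′ ∈ Q

  swapPair : ∀ {z z′} → SeparatorPair z z′ → SeparatorPair z′ z
  swapPair zz′ = record { z≢z′ = z≢z′ ∘ sym ; z∈P = z′∈P ; z∈Q = z′∈Q ; z′∈P = z∈P ; z′∈Q = z∈Q }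
    where open SeparatorPair zz′

  module _ {z z′} (zz′ : SeparatorPair z z′) (f′ : Fate z′) where

    open SeparatorPair zz′

    stayer-degrees : ∀ {K : Graph n} → (∀ {v} → E G z v → E K z v) →
      Deg≥2 (sideP H P Q) z → Deg≥2 (sideQ H Q) z →
      Deg≥2 (sideP K (shiftP f′ P) (shiftQ f′ Q)) z × Deg≥2 (sideQ K (shiftQ f′ Q)) z
    stayer-degrees {K} kept degP degQ =
      Deg≥2-mono {A = sideP H P Q} {sideP K (shiftP f′ P) (shiftQ f′ Q)} P-edge degP ,
      Deg≥2-mono {A = sideQ H Q} {sideQ K (shiftQ f′ Q)} Q-edge degQ
      where
      P-edge : ∀ {x} → E (sideP H P Q) z x → E (sideP K (shiftP f′ P) (shiftQ f′ Q)) z x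
      P-edge (zx , (_ , x∈P) , ¬inQ) =
        kept (proj₁ zx) ,
        (∈shiftP⁺ f′ z∈P z≢z′ , ∈shiftP⁺ f′ x∈P λ { refl → ¬inQ (z∈Q , z′∈Q) }) ,
        λ (_ , x∈Q′) → ¬inQ (z∈Q , shiftQ⊆ f′ x∈Q′)
      Q-edge : ∀ {x} → E (sideQ H Q) z x → E (sideQ K (shiftQ f′ Q)) z x
      Q-edge (zx , _ , x∈Q) =
        kept (proj₁ zx) , ∈shiftQ⁺ f′ z∈Q z≢z′ , ∈shiftQ-neighbour f′ x∈Q zx z∈P z∈Q

    mover-ends : ∀ {x y} (m : Move z x y) →
      (x ∈ shiftP (moves m) (shiftP f′ P) × y ∈ shiftQ (moves m) (shiftQ f′ Q)) ×
      (x ∈ shiftP f′ (shiftP (moves m) P) × y ∈ shiftQ f′ (shiftQ (moves m) Q))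
    mover-ends (toQ w∈P w∉Q _ _) =
      (x∈p∧x≢y⇒x∈p-y (∈shiftP⁺ f′ w∈P w≢z′) w≢z , ∈shiftQ⁺ f′ z∈Q z≢z′) ,
      (∈shiftP⁺ f′ (x∈p∧x≢y⇒x∈p-y w∈P w≢z) w≢z′ , ∈shiftQ⁺ f′ z∈Q z≢z′)
      where
      w≢z : _ ≢ z
      w≢z refl = w∉Q z∈Q
      w≢z′ : _ ≢ z′
      w≢z′ refl = w∉Q z′∈Q
    mover-ends (toP w∈Q w∉P _ _) =
      (∈shiftP⁺ f′ z∈P z≢z′ , x∈p∧x≢y⇒x∈p-y (∈shiftQ⁺ f′ w∈Q w≢z′) w≢z) ,
      (∈shiftP⁺ f′ z∈P z≢z′ , ∈shiftQ⁺ f′ (x∈p∧x≢y⇒x∈p-y w∈Q w≢z) w≢z′)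
      where
      w≢z : _ ≢ z
      w≢z refl = w∉P z∈P
      w≢z′ : _ ≢ z′
      w≢z′ refl = w∉P z′∈P

  module Pair {c d} (cd : SeparatorPair c d) where

    open SeparatorPair cd renaming (z≢z′ to c≢d; z∈P to c∈P; z∈Q to c∈Q; z′∈P to d∈P; z′∈Q to d∈Q)

    module Outcome (fc : Fate c) (fd : Fate d) where

      K : Graph n
      K = G ∖E ((a , b) ∷ deleted fc ++ deleted fd)

      P′ Q′ : Subset n
      P′ = shiftP fc (shiftP fd P)
      Q′ = shiftQ fc (shiftQ fd Q)

      K⊆H : ∀ {u v} → E K u v → E H u v
      K⊆H (uv , avoids-ab ∷ _) = uv , avoids-ab ∷ []

      kept : ∀ {u v} → u ∈ P → u ∈ Q →
        All (Avoids u v) (deleted fc) → All (Avoids u v) (deleted fd) → E G u v → E K u v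
      kept u∈P u∈Q avoids-c avoids-d uv =
        uv , separator-avoids-ab u∈P u∈Q ∷ All.++⁺ avoids-c avoids-d

      split′ : Split K P′ Q′
      split′ =
        shift-split fc K⊆H (All.++⁻ˡ (deleted fc) ∘ All.tail ∘ proj₂)
          (shift-split fd K⊆H (All.++⁻ʳ (deleted fc) ∘ All.tail ∘ proj₂)
            (Split-mono refl K⊆H split) d∈P d∈Q id id (λ x∈Q _ → x∈Q))
          (∈shiftP⁺ fd c∈P c≢d) (∈shiftQ⁺ fd c∈Q c≢d) (shiftP⊆ fd) (shiftQ⊆ fd)
          (λ x∈Q cx → ∈shiftQ-neighbour fd x∈Q cx c∈P c∈Q)

      ∣P′∩Q′∣ : ∣ P′ ∩ Q′ ∣ ≡ stayCount fc + stayCount fd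
      ∣P′∩Q′∣ =
        count (trans (cong (stayCount fd +_) (sym ∣P∩Q∣≡2)) (shift-card fd (x∈p∩q⁺ (d∈P , d∈Q))))
              (shift-card fc (x∈p∩q⁺ (∈shiftP⁺ fd c∈P c≢d , ∈shiftQ⁺ fd c∈Q c≢d)))
        where
        count : ∀ {s t m₁ m} → t + 2 ≡ suc m₁ → s + m₁ ≡ suc m → m ≡ s + t
        count {s} {t} {m₁} eq₁ eq₂ = suc-injective (begin
          suc _    ≡⟨ sym eq₂ ⟩
          s + m₁    ≡⟨ cong (s +_) (suc-injective (trans (sym eq₁) (+-comm t 2))) ⟩
          s + suc t ≡⟨ +-suc s t ⟩
          suc (s + t) ∎)
          where open ≡-Reasoning

      interior-P : ∀ {x} → x ∈ P → x ∉ Q → x ∈ P′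
      interior-P x∈P x∉Q = ∈shiftP⁺ fc (∈shiftP⁺ fd x∈P λ { refl → x∉Q d∈Q }) λ { refl → x∉Q c∈Q }

      interior-Q : ∀ {x} → x ∈ Q → x ∉ P → x ∈ Q′
      interior-Q x∈Q x∉P = ∈shiftQ⁺ fc (∈shiftQ⁺ fd x∈Q λ { refl → x∉P d∈P }) λ { refl → x∉P c∈P }

      a∈P′ : a ∈ P′
      a∈P′ = interior-P a∈P a∉Q

      b∈Q′ : b ∈ Q′
      b∈Q′ = interior-Q b∈Q b∉P

      sep : KSep (stayCount fc + stayCount fd) K
      sep = Split⇒KSep K split′ ∣P′∩Q′∣
        a∈P′ (a∉Q ∘ shiftQ⊆ fd ∘ shiftQ⊆ fc) b∈Q′ (b∉P ∘ shiftP⊆ fd ∘ shiftP⊆ fc)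

    ∈V : ∀ {x} → x ∈ P → x ∈ V G
    ∈V x∈P = ∈P⊎Q⇒∈V split (inj₁ x∈P)

    bothStay : Deg≥2 (sideP H P Q) c → Deg≥2 (sideQ H Q) c →
      Deg≥2 (sideP H P Q) d → Deg≥2 (sideQ H Q) d → HasCompatibleWith G a b
    bothStay cP cQ dP dQ = inj₂ (inj₂
      (a , b , c , d , inj₁ (refl , refl) , ∈V c∈P , ∈V d∈P , c≢d , sep ,
       (a∈P′ , c∈P , d∈P) , (b∈Q′ , c∈Q , d∈Q) ,
       proj₁ c-degrees , proj₂ c-degrees , proj₁ d-degrees , proj₂ d-degrees))
      where
      open Outcome (stays cP cQ) (stays dP dQ)
      c-degrees : Deg≥2 (sideP K P′ Q′) c × Deg≥2 (sideQ K Q′) c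
      c-degrees = stayer-degrees cd (stays dP dQ) {K} (kept c∈P c∈Q [] []) cP cQ
      d-degrees : Deg≥2 (sideP K P′ Q′) d × Deg≥2 (sideQ K Q′) d
      d-degrees = stayer-degrees (swapPair cd) (stays cP cQ) {K} (kept d∈P d∈Q [] []) dP dQ

    cStays-dMoves : Deg≥2 (sideP H P Q) c → Deg≥2 (sideQ H Q) c → ∀ {x y} → Move d x y →
      HasCompatibleWith G a b
    cStays-dMoves cP cQ {x} {y} m = inj₂ (inj₁
      (a , b , x , y , c , inj₁ (refl , refl) , move-edge m , move-avoids-ab m d∈P d∈Q , ∈V c∈P ,
       sep , (a∈P′ , proj₁ ends , ∈shiftP⁺ (moves m) c∈P c≢d) ,
       (b∈Q′ , proj₂ ends , ∈shiftQ⁺ (moves m) c∈Q c≢d) ,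
       proj₁ c-degrees , proj₂ c-degrees))
      where
      open Outcome (stays cP cQ) (moves m)
      ends : x ∈ P′ × y ∈ Q′
      ends = proj₂ (mover-ends (swapPair cd) (stays cP cQ) m)
      c-degrees : Deg≥2 (sideP K P′ Q′) c × Deg≥2 (sideQ K Q′) c
      c-degrees = stayer-degrees cd (moves m) {K}
        (kept c∈P c∈Q [] (separator-avoids (moves m) c∈P c∈Q c≢d)) cP cQ

    bothMove : ∀ {x y x′ y′} → Move c x y → Move d x′ y′ → HasCompatibleWith G a b
    bothMove {x} {y} {x′} {y′} m m′ = inj₁
      (a , b , x , y , x′ , y′ , inj₁ (refl , refl) , move-edge m , move-edge m′ ,
       move-avoids-ab m c∈P c∈Q , move-avoids-ab m′ d∈P d∈Q , moves-distinct m m′ c∈P c∈Q c≢d ,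
       sep ,
       (a∈P′ , proj₁ c-ends , proj₁ d-ends) , (b∈Q′ , proj₂ c-ends , proj₂ d-ends))
      where
      open Outcome (moves m) (moves m′)
      c-ends : x ∈ P′ × y ∈ Q′
      c-ends = proj₁ (mover-ends cd (moves m′) m)
      d-ends : x′ ∈ P′ × y′ ∈ Q′
      d-ends = proj₂ (mover-ends (swapPair cd) (moves m) m′)

  compatible : ∀ {c d} → SeparatorPair c d → Fate c → Fate d → HasCompatibleWith G a b
  compatible cd (stays cP cQ) (stays dP dQ) = Pair.bothStay cd cP cQ dP dQ
  compatible cd (stays cP cQ) (moves m)     = Pair.cStays-dMoves cd cP cQ m
  compatible cd (moves m)     (stays dP dQ) = Pair.cStays-dMoves (swapPair cd) dP dQ m
  compatible cd (moves m)     (moves m′)    = Pair.bothMove cd m m′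

  compatible-set : HasCompatibleWith G a b
  compatible-set with c , d , c≢d , c∈P∩Q , d∈P∩Q ← 2≤∣p∣⇒distinct (≤-reflexive (sym ∣P∩Q∣≡2))
    with c∈P , c∈Q ← x∈p∩q⁻ P Q c∈P∩Q | d∈P , d∈Q ← x∈p∩q⁻ P Q d∈P∩Q
    = compatible (record { z≢z′ = c≢d ; z∈P = c∈P ; z∈Q = c∈Q ; z′∈P = d∈P ; z′∈Q = d∈Q })
                 (fate c∈P c∈Q) (fate d∈P d∈Q)

-- 2-separations of G ∖ ab

module DeletedEdge {n} (G : Graph n) (E? : ∀ u v → Dec (E G u v)) (G-conn : KConnected 3 G)
                   {a b : Fin n} (ab : E G a b) where

  H : Graph n
  H = G ∖E ((a , b) ∷ [])

  a≢b : a ≢ b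
  a≢b refl = E-irr G ab

  H-conn : KConnected 2 H
  H-conn = ∖E-connected G a≢b G-conn

  E?H : ∀ u v → Dec (E H u v)
  E?H = ∖E-dec G E? ((a , b) ∷ [])

  a∈V : a ∈ V G
  a∈V = E-V G ab

  b∈V : b ∈ V G
  b∈V = E-V G (E-sym G ab)

  TwoSplit : Subset n → Subset n → Set
  TwoSplit P Q = Split H P Q × ∣ P ∩ Q ∣ ≡ 2 × (∃[ x ] (x ∈ P × x ∉ Q)) × (∃[ y ] (y ∈ Q × y ∉ P))

  twoSplit? : Dec (∃[ P ] ∃[ Q ] TwoSplit P Q)
  twoSplit? = anySubset? λ P → anySubset? λ Q →
    split? H E?H P Q ×-dec ∣ P ∩ Q ∣ ℕ.≟ 2 ×-dec
    any? (λ x → x ∈? P ×-dec ¬? (x ∈? Q)) ×-dec any? (λ y → y ∈? Q ×-dec ¬? (y ∈? P))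

  KSep⇒TwoSplit : (S : KSep 2 H) → TwoSplit (V (A S)) (V (B S))
  KSep⇒TwoSplit S = KSep⇒Split H S , meet S , interior (bigA S) (meet S) ,
    interior (bigB S) (trans (∣p∩q∣≡∣q∩p∣ (V (B S)) (V (A S))) (meet S))
    where
    interior : ∀ {R R′} → 3 ≤ ∣ R ∣ → ∣ R ∩ R′ ∣ ≡ 2 → ∃[ x ] (x ∈ R × x ∉ R′)
    interior 3≤∣R∣ ∣R∩R′∣≡2 = ∣p∩q∣<∣p∣⇒∃p∖q (subst (_< _) (sym ∣R∩R′∣≡2) 3≤∣R∣)

  TwoSplit-swap : ∀ {P Q} → TwoSplit P Q → TwoSplit Q P
  TwoSplit-swap {P} {Q} (split , ∣P∩Q∣≡2 , P∖Q≢∅ , Q∖P≢∅) =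
    Split-swap split , trans (∣p∩q∣≡∣q∩p∣ Q P) ∣P∩Q∣≡2 , Q∖P≢∅ , P∖Q≢∅

  ends-apart : ∀ {P Q} → TwoSplit P Q → (a ∈ P × b ∈ P) ⊎ (a ∈ Q × b ∈ Q) → ⊥
  ends-apart (split , ∣P∩Q∣≡2 , (x , x∈P , x∉Q) , (y , y∈Q , y∉P)) ends-inside
    with s≤s (s≤s ()) ← subst (3 ≤_) ∣P∩Q∣≡2
                          (k≤∣P∩Q∣ (Split-∖E⁻ split ends-inside) G-conn x∈P x∉Q y∈Q y∉P)

  oriented⇒compatible : ∀ {P Q} → TwoSplit P Q → a ∈ P → a ∉ Q → b ∈ Q → b ∉ P →
    HasCompatibleWith G a b
  oriented⇒compatible (split , ∣P∩Q∣≡2 , _) =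
    SeparatorMoves.compatible-set G H-conn E?H split ∣P∩Q∣≡2

  TwoSplit⇒compatible : ∀ {P Q} → TwoSplit P Q → HasCompatibleWith G a b
  TwoSplit⇒compatible {P} {Q} two@(split , _) with a ∈? Q | b ∈? P
  ... | no a∉Q  | no b∉P  =
    oriented⇒compatible two (∉Q⇒∈P split a∈V a∉Q) a∉Q (∉P⇒∈Q split b∈V b∉P) b∉P
  ... | yes a∈Q | no b∉P  = ⊥-elim (ends-apart two (inj₂ (a∈Q , ∉P⇒∈Q split b∈V b∉P)))
  ... | no a∉Q  | yes b∈P = ⊥-elim (ends-apart two (inj₁ (∉Q⇒∈P split a∈V a∉Q , b∈P)))
  ... | yes a∈Q | yes b∈P with a ∈? P | b ∈? Q
  ...   | yes a∈P | _       = ⊥-elim (ends-apart two (inj₁ (a∈P , b∈P)))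
  ...   | _       | yes b∈Q = ⊥-elim (ends-apart two (inj₂ (a∈Q , b∈Q)))
  ...   | no a∉P  | no b∉Q  = oriented⇒compatible (TwoSplit-swap two) a∈Q a∉P b∈P b∉Q

  compatible⊎internally3Conn : HasCompatibleWith G a b ⊎ Internally3Conn H
  compatible⊎internally3Conn with twoSplit?
  ... | yes (_ , _ , two) = inj₁ (TwoSplit⇒compatible two)
  ... | no ¬two = inj₂ (H-conn , proj₁ G-conn , λ S → ⊥-elim (¬two (_ , _ , KSep⇒TwoSplit S)))

lemma5p5 : ∀ {n} (G : Graph n) (a b : Fin n) →
    SuperMin3Conn G → E G a b →
    ¬ Internally3Conn (G ∖E ((a , b) ∷ [])) →
    HasCompatibleWith G a b
lemma5p5 G a b (G-conn , minimal) ab ¬internally =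
  [ id , ⊥-elim ∘ ¬internally ] (DeletedEdge.compatible⊎internally3Conn G E? G-conn ab)
  where
  E? : ∀ u v → Dec (E G u v)
  E? = MinimallyConnected.E? G G-conn minimal
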